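{- Let $s$ be a positive integer, let $LB$ be an integer, and let $G=(V,E)$ be a finite simple undirected graph. Let $v\in V$ and let $N_G(v)$ be the set of neighbors of $v$ in $G$. Suppose $N_G(v)$ is partitioned into pairwise disjoint sets $V_1,\dots,V_k$ such that each induced subgraph $G[V_i]$ is an $s$-component, and suppose $$PUB(G[N_G(v)],s)=\sum_{i=1}^k\min\{|V_i|,s\}\le LB-s.$$ Then every $S\subseteq V$ with $v\in S$ such that $G[S]$ is an $s$-bundle satisfies $|S|\le LB$; i.e., there is no $s$-bundle containing $v$ with more than $LB$ vertices, so $v$ may be removed from $G$ when searching for an $s$-bundle of size larger than $LB$.
   Context: For a graph $H$, the (vertex) connectivity $\kappa(H)$ is the minimum number of vertices whose removal yields a disconnected graph or a trivial graph with at most one vertex. For $S\subseteq V$, $G[S]$ denotes the subgraph of $G$ induced by $S$. Given a positive integer $s$, a graph $H=(W,F)$ is an $s$-bundle if $\kappa(H)\ge |W|-s$. An $s$-component is a graph whose largest connected subgraph contains at most $s$ vertices. $PUB(H,s)$ denotes the partition-based upper bound $\sum_i \min\{|V_i|,s\}$ computed from a partition of the vertex set of $H$ into sets $V_i$ each inducing an $s$-component. -}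

module Defs where

open import Data.Nat using (ℕ; zero; suc; _+_; _∸_; _≤_; _<_; _⊓_)
open import Data.Bool using (Bool; true; false; T)
open import Data.Fin using (Fin) renaming (zero to fzero; suc to fsuc)
open import Data.Fin.Subset using (Subset; _∈_; _⊆_; _─_; ∣_∣)
open import Data.Vec using (tabulate)
open import Data.Product using (_×_; Σ; ∃)
open import Relation.Binary.PropositionalEquality using (_≡_; _≢_)

record Graph (n : ℕ) : Set where
  field
    adj     : Fin n → Fin n → Bool
    symm    : ∀ x y → adj x y ≡ adj y x
    irrefl  : ∀ x → adj x x ≡ false

open Graph public

module _ {n : ℕ} (G : Graph n) where

  Adj : Fin n → Fin n → Set
  Adj x y = T (adj G x y)

  nbhd : Fin n → Subset n
  nbhd v = tabulate (adj G v)

  data Reach (W : Subset n) : Fin n → Fin n → Set where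
    here : ∀ {x} → x ∈ W → Reach W x x
    step : ∀ {x y z} → x ∈ W → Adj x y → Reach W y z → Reach W x z

  Connected : Subset n → Set
  Connected W = ∀ x y → x ∈ W → y ∈ W → Reach W x y

  -- κ(G[W]) ≥ t : removing fewer than t vertices of W never leaves a
  -- disconnected graph or a trivial graph with at most one vertex.
  ConnAtLeast : Subset n → ℕ → Set
  ConnAtLeast W t = ∀ X → X ⊆ W → ∣ X ∣ < t →
                    Connected (W ─ X) × 2 ≤ ∣ W ─ X ∣

  IsBundle : ℕ → Subset n → Set
  IsBundle s W = ConnAtLeast W (∣ W ∣ ∸ s)

  -- G[W] is an s-component : every connected subgraph has at most s vertices
  -- (a vertex set C spans a connected subgraph iff G[C] is connected)
  IsComponent : ℕ → Subset n → Set
  IsComponent s W = ∀ C → C ⊆ W → Connected C → ∣ C ∣ ≤ s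

sumFin : (k : ℕ) → (Fin k → ℕ) → ℕ
sumFin zero    f = 0
sumFin (suc k) f = f fzero + sumFin k (λ i → f (fsuc i))

PUB : ∀ {n} (k : ℕ) → (Fin k → Subset n) → ℕ → ℕ
PUB k V s = sumFin k (λ i → ∣ V i ∣ ⊓ s)

IsPartition : ∀ {n} (U : Subset n) (k : ℕ) → (Fin k → Subset n) → Set
IsPartition {n} U k V =
    (∀ i j (x : Fin n) → x ∈ V i → x ∈ V j → i ≡ j)
  × (∀ (x : Fin n) → x ∈ U → ∃ λ i → x ∈ V i)
  × (∀ i → V i ⊆ U)

-- Deleting S ∩ N(v) from an s-bundle S isolates v, so the rest cannot be connected
-- with two vertices; as fewer than |S| − s deletions keep a bundle connected with two
-- vertices, |S| ≤ |S ∩ N(v)| + s. Likewise deleting S ─ Vᵢ leaves a connected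
-- subgraph of the s-component G[Vᵢ] unless at most s vertices remain, so
-- |S ∩ Vᵢ| ≤ min(|Vᵢ|, s); summing over the cover, |S ∩ N(v)| ≤ PUB ≤ LB − s.
module Submission where

open import Defs
open import Data.Nat using (ℕ; _≤_)
open import Data.Integer as ℤ using (ℤ; +_; _-_)
open import Data.Fin using (Fin)
open import Data.Fin.Subset using (Subset; _∈_; ∣_∣)

open import Algebra.Bundles using (AbelianGroup)
import Data.Integer.Properties as ℤᵖ
open import Algebra.Properties.Group (AbelianGroup.group ℤᵖ.+-0-abelianGroup)
  using (//-rightDividesˡ)
open import Data.Bool using (true)
open import Data.Bool.Properties using (T-≡)
open import Data.Fin using () renaming (zero to fzero; suc to fsuc)
open import Data.Fin.Subset using (_∉_; _⊆_; _∩_; _─_; ⁅_⁆; ⊥; inside; outside)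
open import Data.Fin.Subset.Properties
  using (_∈?_; p⊆q⇒∣p∣≤∣q∣; ∣⊥∣≡0; ∣⁅x⁆∣≡1; x∈⁅x⁆; x∈p∩q⁺; x∈p∩q⁻; p∩q⊆p;
         ∣p∩q∣≤∣q∣; x∈p∧x∉q⇒x∈p─q; p─q⊆p)
open import Data.Nat using (suc; _+_; _∸_; _<_)
open import Data.Nat.Properties
  using (≤-refl; ≤-trans; ≤-reflexive; +-suc; +-mono-≤; +-monoʳ-≤; +-monoˡ-≤; +-monoʳ-<;
         ⊓-glb; ≮⇒≥; <⇒≱; m+n≤o⇒m≤o∸n; module ≤-Reasoning)
open import Data.Product using (_×_; _,_; proj₁; proj₂; ∃)
open import Data.Vec using (_∷_; []; here; there)
open import Data.Vec.Properties using (lookup⇒[]=; []=⇒lookup; lookup∘tabulate)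
open import Function using (_∘_; case_of_; Equivalence)
open import Relation.Nullary using (¬_; yes; no; contradiction)
open import Relation.Binary.PropositionalEquality using (_≡_; refl; sym; trans; cong)

private variable n : ℕ

x∈p─q⇒x∉q : ∀ {p q : Subset n} {x} → x ∈ p ─ q → x ∉ q
x∈p─q⇒x∉q {p = _ ∷ _} {outside ∷ _}           here ()
x∈p─q⇒x∉q {p = _ ∷ _} {inside  ∷ _} {x = fzero} ()
x∈p─q⇒x∉q {p = _ ∷ _} {_       ∷ _} (there x∈p─q) (there x∈q) = x∈p─q⇒x∉q x∈p─q x∈q

p─[p─q]⊆q : ∀ (p q : Subset n) → p ─ (p ─ q) ⊆ q
p─[p─q]⊆q p q {x} x∈p─[p─q] with x ∈? q
... | yes x∈q = x∈q
... | no  x∉q =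
  contradiction (x∈p∧x∉q⇒x∈p─q (p─q⊆p p _ x∈p─[p─q]) x∉q) (x∈p─q⇒x∉q x∈p─[p─q])

p∩q⊆p─[p─q] : ∀ (p q : Subset n) → p ∩ q ⊆ p ─ (p ─ q)
p∩q⊆p─[p─q] p q x∈p∩q with x∈p∩q⁻ p q x∈p∩q
... | x∈p , x∈q = x∈p∧x∉q⇒x∈p─q x∈p (λ x∈p─q → x∈p─q⇒x∉q x∈p─q x∈q)

∣p∩q∣+∣p─q∣≡∣p∣ : ∀ (p q : Subset n) → ∣ p ∩ q ∣ + ∣ p ─ q ∣ ≡ ∣ p ∣
∣p∩q∣+∣p─q∣≡∣p∣ []            []            = refl
∣p∩q∣+∣p─q∣≡∣p∣ (outside ∷ p) (outside ∷ q) = ∣p∩q∣+∣p─q∣≡∣p∣ p q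
∣p∩q∣+∣p─q∣≡∣p∣ (outside ∷ p) (inside  ∷ q) = ∣p∩q∣+∣p─q∣≡∣p∣ p q
∣p∩q∣+∣p─q∣≡∣p∣ (inside  ∷ p) (inside  ∷ q) = cong suc (∣p∩q∣+∣p─q∣≡∣p∣ p q)
∣p∩q∣+∣p─q∣≡∣p∣ (inside  ∷ p) (outside ∷ q) =
  trans (+-suc _ _) (cong suc (∣p∩q∣+∣p─q∣≡∣p∣ p q))

∣p∣≤∣q∣+∣p─q∣ : ∀ (p q : Subset n) → ∣ p ∣ ≤ ∣ q ∣ + ∣ p ─ q ∣
∣p∣≤∣q∣+∣p─q∣ p q = begin
  ∣ p ∣                 ≡⟨ sym (∣p∩q∣+∣p─q∣≡∣p∣ p q) ⟩
  ∣ p ∩ q ∣ + ∣ p ─ q ∣ ≤⟨ +-monoˡ-≤ ∣ p ─ q ∣ (∣p∩q∣≤∣q∣ p q) ⟩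
  ∣ q ∣ + ∣ p ─ q ∣     ∎
  where open ≤-Reasoning

q⊆p⇒∣q∣+∣p─q∣≤∣p∣ : ∀ {p q : Subset n} → q ⊆ p → ∣ q ∣ + ∣ p ─ q ∣ ≤ ∣ p ∣
q⊆p⇒∣q∣+∣p─q∣≤∣p∣ {p = p} {q} q⊆p = begin
  ∣ q ∣ + ∣ p ─ q ∣     ≤⟨ +-monoˡ-≤ ∣ p ─ q ∣ (p⊆q⇒∣p∣≤∣q∣ q⊆p∩q) ⟩
  ∣ p ∩ q ∣ + ∣ p ─ q ∣ ≡⟨ ∣p∩q∣+∣p─q∣≡∣p∣ p q ⟩
  ∣ p ∣                 ∎
  where
  open ≤-Reasoning
  q⊆p∩q : q ⊆ p ∩ q
  q⊆p∩q x∈q = x∈p∩q⁺ (q⊆p x∈q , x∈q)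

∣p∣≤sum-of-cover : ∀ k (W : Fin k → Subset n) {p : Subset n} →
                   (∀ {x} → x ∈ p → ∃ λ i → x ∈ W i) →
                   ∣ p ∣ ≤ sumFin k (λ i → ∣ W i ∣)
∣p∣≤sum-of-cover {n} 0       W {p} cover =
  ≤-trans (p⊆q⇒∣p∣≤∣q∣ p⊆⊥) (≤-reflexive (∣⊥∣≡0 n))
  where
  p⊆⊥ : p ⊆ ⊥
  p⊆⊥ x∈p with cover x∈p
  ... | () , _
∣p∣≤sum-of-cover (suc k) W {p} cover =
  ≤-trans (∣p∣≤∣q∣+∣p─q∣ p (W fzero))
          (+-monoʳ-≤ ∣ W fzero ∣ (∣p∣≤sum-of-cover k (W ∘ fsuc) cover′))
  where
  cover′ : ∀ {x} → x ∈ p ─ W fzero → ∃ λ i → x ∈ W (fsuc i)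
  cover′ x∈p─W₀ with cover (p─q⊆p p _ x∈p─W₀)
  ... | fzero  , x∈W₀ = contradiction x∈W₀ (x∈p─q⇒x∉q x∈p─W₀)
  ... | fsuc i , x∈Wᵢ = i , x∈Wᵢ

sumFin-mono : ∀ k {f g : Fin k → ℕ} → (∀ i → f i ≤ g i) → sumFin k f ≤ sumFin k g
sumFin-mono 0       f≤g = ≤-refl
sumFin-mono (suc k) f≤g = +-mono-≤ (f≤g fzero) (sumFin-mono k (f≤g ∘ fsuc))

module _ (G : Graph n) where

  adj⇒∈nbhd : ∀ {v x} → Adj G v x → x ∈ nbhd G v
  adj⇒∈nbhd {v} {x} v~x =
    lookup⇒[]= x (nbhd G v) (trans (lookup∘tabulate (adj G v) x) (Equivalence.to T-≡ v~x))

  v∉nbhd : ∀ v → v ∉ nbhd G v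
  v∉nbhd v v∈N = case trans (sym adj-v-v≡true) (irrefl G v) of λ ()
    where
    adj-v-v≡true : adj G v v ≡ true
    adj-v-v≡true = trans (sym (lookup∘tabulate (adj G v) v)) ([]=⇒lookup v∈N)

  reach-source : ∀ {W x y} → Reach G W x y → x ∈ W
  reach-source (here x∈W)     = x∈W
  reach-source (step x∈W _ _) = x∈W

  connected-isolated⇒∣W∣≤1 : ∀ {W v} → Connected G W → v ∈ W →
                              (∀ {y} → y ∈ W → ¬ Adj G v y) → ∣ W ∣ ≤ 1
  connected-isolated⇒∣W∣≤1 {W} {v} connected v∈W isolated =
    ≤-trans (p⊆q⇒∣p∣≤∣q∣ W⊆⁅v⁆) (≤-reflexive (∣⁅x⁆∣≡1 v))
    where
    W⊆⁅v⁆ : W ⊆ ⁅ v ⁆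
    W⊆⁅v⁆ {y} y∈W with connected v y v∈W y∈W
    ... | here _         = x∈⁅x⁆ v
    ... | step _ v~z z⇝y = contradiction v~z (isolated (reach-source z⇝y))

  module _ {s : ℕ} {S : Subset n} (bundle : IsBundle G s S) where

    bundle-remainder : ∀ {X} → X ⊆ S → s < ∣ S ─ X ∣ →
                       Connected G (S ─ X) × 2 ≤ ∣ S ─ X ∣
    bundle-remainder {X} X⊆S s<∣S─X∣ = bundle X X⊆S ∣X∣<∣S∣∸s
      where
      open ≤-Reasoning
      ∣X∣<∣S∣∸s : ∣ X ∣ < ∣ S ∣ ∸ s
      ∣X∣<∣S∣∸s = m+n≤o⇒m≤o∸n (suc ∣ X ∣) (begin
        suc (∣ X ∣ + s)   ≤⟨ +-monoʳ-< ∣ X ∣ s<∣S─X∣ ⟩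
        ∣ X ∣ + ∣ S ─ X ∣ ≤⟨ q⊆p⇒∣q∣+∣p─q∣≤∣p∣ X⊆S ⟩
        ∣ S ∣             ∎)

    ∣bundle∩component∣≤s : ∀ {C} → IsComponent G s C → ∣ S ∩ C ∣ ≤ s
    ∣bundle∩component∣≤s {C} component =
      ≤-trans (p⊆q⇒∣p∣≤∣q∣ (p∩q⊆p─[p─q] S C)) ∣R∣≤s
      where
      R = S ─ (S ─ C)
      ∣R∣≤s : ∣ R ∣ ≤ s
      ∣R∣≤s = ≮⇒≥ λ s<∣R∣ →
        <⇒≱ s<∣R∣ (component R (p─[p─q]⊆q S C)
                    (proj₁ (bundle-remainder (p─q⊆p S C) s<∣R∣)))

    ∣bundle∣≤∣bundle∩nbhd∣+s : ∀ {v} → v ∈ S → ∣ S ∣ ≤ ∣ S ∩ nbhd G v ∣ + s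
    ∣bundle∣≤∣bundle∩nbhd∣+s {v} v∈S =
      ≤-trans (∣p∣≤∣q∣+∣p─q∣ S X) (+-monoʳ-≤ ∣ X ∣ ∣R∣≤s)
      where
      X = S ∩ nbhd G v
      R = S ─ X
      v∈R : v ∈ R
      v∈R = x∈p∧x∉q⇒x∈p─q v∈S (v∉nbhd v ∘ proj₂ ∘ x∈p∩q⁻ S (nbhd G v))
      v-isolated-in-R : ∀ {y} → y ∈ R → ¬ Adj G v y
      v-isolated-in-R y∈R v~y =
        x∈p─q⇒x∉q y∈R (x∈p∩q⁺ (p─q⊆p S X y∈R , adj⇒∈nbhd v~y))
      ∣R∣≤s : ∣ R ∣ ≤ s
      ∣R∣≤s = ≮⇒≥ λ s<∣R∣ →
        let connected , 2≤∣R∣ = bundle-remainder (p∩q⊆p S (nbhd G v)) s<∣R∣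
        in <⇒≱ 2≤∣R∣ (connected-isolated⇒∣W∣≤1 connected v∈R v-isolated-in-R)

    ∣bundle∩U∣≤PUB : ∀ {U k} {V : Fin k → Subset n} →
                     (∀ x → x ∈ U → ∃ λ i → x ∈ V i) →
                     (∀ i → IsComponent G s (V i)) →
                     ∣ S ∩ U ∣ ≤ PUB k V s
    ∣bundle∩U∣≤PUB {U} {k} {V} covers components =
      ≤-trans (∣p∣≤sum-of-cover k (λ i → S ∩ V i) S∩U-covered)
              (sumFin-mono k λ i → ⊓-glb (∣p∩q∣≤∣q∣ S (V i))
                                         (∣bundle∩component∣≤s (components i)))
      where
      S∩U-covered : ∀ {x} → x ∈ S ∩ U → ∃ λ i → x ∈ S ∩ V i
      S∩U-covered {x} x∈S∩U with x∈p∩q⁻ S U x∈S∩U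
      ... | x∈S , x∈U with covers x x∈U
      ... | i , x∈Vᵢ = i , x∈p∩q⁺ (x∈S , x∈Vᵢ)

mainTheorem2 : (s : ℕ) → 1 ≤ s → (LB : ℤ) → (n : ℕ) → (G : Graph n) → (v : Fin n)
    → (k : ℕ) → (V : Fin k → Subset n)
    → IsPartition (nbhd G v) k V
    → (∀ i → IsComponent G s (V i))
    → (+ PUB k V s) ℤ.≤ LB - + s
    → (S : Subset n) → v ∈ S → IsBundle G s S
    → (+ ∣ S ∣) ℤ.≤ LB
mainTheorem2 s _ LB n G v k V (_ , covers , _) components PUB≤LB-s S v∈S bundle =
  begin
    + ∣ S ∣             ≤⟨ ℤ.+≤+ ∣S∣≤PUB+s ⟩
    + PUB k V s ℤ.+ + s ≤⟨ ℤᵖ.+-monoˡ-≤ (+ s) PUB≤LB-s ⟩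
    LB - + s ℤ.+ + s    ≡⟨ //-rightDividesˡ (+ s) LB ⟩
    LB                  ∎
  where
  open ℤᵖ.≤-Reasoning
  ∣S∣≤PUB+s : ∣ S ∣ ≤ PUB k V s + s
  ∣S∣≤PUB+s = ≤-trans (∣bundle∣≤∣bundle∩nbhd∣+s G bundle v∈S)
                      (+-monoˡ-≤ s (∣bundle∩U∣≤PUB G bundle covers components))
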